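{- Let $n\ge2$ and let $L_n$ be the lattice of arithmetic progressions in $[n]$. Then $L_n$ is complemented if and only if $n-1$ is squarefree. In particular, if $n-1$ is not squarefree, there exists an element $x\in L_n$ with $x\notin\{\emptyset,[n]\}$ whose only upper semicomplement is $[n]$.
   Context: $L_n$ is the set of all subsets of $[n]=\{1,\ldots,n\}$ that are arithmetic progressions $\{a,a+r,\ldots,a+(k-1)r\}$ ($a$, $r\ge1$, $k\ge0$ integers; including $\emptyset$, singletons and $2$-element subsets), ordered by inclusion; it is a lattice with minimum $\emptyset$, maximum $[n]$, meet given by intersection and join given by the smallest progression containing both. A lattice with minimum $\hat0$ and maximum $\hat1$ is complemented if for every $x$ there is $y$ with $x\vee y=\hat1$ and $x\wedge y=\hat0$. An upper semicomplement of $x$ is an element $y$ with $x\vee y=\hat1$. -}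

module Defs where

open import Data.Nat using (ℕ; suc; _+_; _*_; _≤_; _<_)
open import Data.Nat.Divisibility using (_∣_)
open import Data.Fin using (Fin; toℕ)
open import Data.Fin.Subset using (Subset; _∈_; _⊆_; ⊤; ⊥)
open import Data.Product using (Σ; ∃; _×_)
open import Relation.Binary.PropositionalEquality using (_≡_)
open import Function.Bundles using (_⇔_)

-- Subsets of [n] = {1,…,n} are represented as 'Subset n' (Vec Bool n);
-- the index i : Fin n stands for the number toℕ i + 1 ∈ [n].

IsAP : (n : ℕ) → Subset n → Set
IsAP n p =
  Σ ℕ λ a → Σ ℕ λ r → Σ ℕ λ k →
    (1 ≤ a) × (1 ≤ r) ×
    (∀ j → j < k → a + j * r ≤ n) ×
    (∀ (i : Fin n) → (i ∈ p) ⇔ (Σ ℕ λ j → (j < k) × (suc (toℕ i) ≡ a + j * r)))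

-- In the lattice L_n: the join of x and y is the top [n], i.e. [n] is the least
-- upper bound of x and y among progressions (it is always an upper bound).
JoinIsTop : (n : ℕ) → Subset n → Subset n → Set
JoinIsTop n x y = ∀ z → IsAP n z → x ⊆ z → y ⊆ z → ⊤ ⊆ z

MeetIsBot : (n : ℕ) → Subset n → Subset n → Set
MeetIsBot n x y = ∀ z → IsAP n z → z ⊆ x → z ⊆ y → z ⊆ ⊥

Complemented : ℕ → Set
Complemented n =
  ∀ x → IsAP n x → Σ (Subset n) λ y → IsAP n y × JoinIsTop n x y × MeetIsBot n x y

Squarefree : ℕ → Set
Squarefree m = ∀ d → d * d ∣ m → d ≡ 1

-- Shift [n] down to the positions 0, …, N with N = n − 1, so that the number
-- t + 1 sits at position t.  A progression containing position 0 is a set of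
-- multiples of its step, hence the progression generated by a set w is [n]
-- exactly when w contains 0 and N and its positions have no common divisor
-- d > 1 (such a d would give the proper progression 0, d, 2d, …, N).
--
-- If N = p²q with p ≥ 2, let x = {pq}.  Any y with x ∨ y = [n] contains 0 and
-- N, and a common divisor e of the positions of y is coprime to pq, so e ∣ p
-- because e ∣ N = p·pq; then e ∣ pq and e = 1.  Thus y = [n] and x has no
-- complement.  If N is squarefree, a progression x avoiding 0 and N whose
-- positions have gcd G is complemented by the progression 0, s, 2s, …, N with
-- g = gcd(G, N) and N = gs: squarefreeness makes g and s coprime, which gives
-- both x ∨ y = [n] and x ∧ y = ∅.  A progression containing 0 or N is
-- complemented by one or two points next to the missing end.
{-# OPTIONS --safe #-}
module Submission where

open import Defs
open import Data.Nat using (ℕ; _≤_; _∸_)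
open import Data.Fin.Subset using (Subset; ⊤; ⊥)
open import Data.Product using (Σ; _×_)
open import Relation.Binary.PropositionalEquality using (_≡_; _≢_)
open import Relation.Nullary using (¬_)
open import Function.Bundles using (_⇔_)

open import Data.Nat
  using (zero; suc; _+_; _*_; _<_; z≤n; s≤s; s≤s⁻¹; s<s⁻¹; z<s; s<s; _≟_; _≤?_)
open import Data.Nat using (>-nonZero; >-nonZero⁻¹; ≢-nonZero)
open import Data.Nat.Properties
open import Data.Nat.Divisibility
open import Data.Nat.GCD using (gcd; gcd[m,n]∣m; gcd[m,n]∣n; gcd-greatest; gcd[m,n]≢0)
open import Data.Nat.Coprimality using (Coprime; coprime-divisor)
import Data.Nat.Coprimality as Coprime
open import Data.Nat.Tactic.RingSolver using (solve-∀)
open import Data.Fin using (Fin; toℕ; fromℕ<)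
open import Data.Fin.Properties using (toℕ-injective; toℕ<n; toℕ-fromℕ<; any?)
open import Data.Fin.Subset using (_∈_; _⊆_; _∪_)
open import Data.Fin.Subset.Properties
  using (_∈?_; ∈⊤; ∉⊥; ⊆⊤; ⊥⊆; ⊆-refl; ⊆-trans; ⊆-antisym; p⊆p∪q; q⊆p∪q; x∈p∪q⁻)
open import Data.Vec using (tabulate)
open import Data.Vec.Properties using (lookup∘tabulate; []=⇒lookup; lookup⇒[]=)
open import Data.Bool.Properties using (T-≡)
open import Data.Product using (_,_; proj₁; proj₂)
import Data.Product as Product
open import Data.Sum using (_⊎_; inj₁; inj₂; [_,_]′)
import Data.Sum as Sum
open import Relation.Nullary using (Dec; yes; no; contradiction)
open import Relation.Nullary.Decidable using (⌊_⌋; _×-dec_; toWitness; fromWitness)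
open import Relation.Binary.PropositionalEquality using (refl; sym; trans; cong; cong₂; subst)
open import Function.Bundles using (mk⇔; Equivalence)
open Equivalence using (to; from)

private variable
  n N M a r k d j t : ℕ

infix 4 _∈ᵖ_ _∈ᵖ?_

_∈ᵖ_ : ℕ → Subset n → Set
_∈ᵖ_ {n} t z = Σ (Fin n) λ i → i ∈ z × toℕ i ≡ t

∈⇒∈ᵖ : {z : Subset n} {i : Fin n} → i ∈ z → toℕ i ∈ᵖ z
∈⇒∈ᵖ i∈z = _ , i∈z , refl

∈ᵖ⇒∈ : {z : Subset n} {i : Fin n} → toℕ i ∈ᵖ z → i ∈ z
∈ᵖ⇒∈ {z = z} (_ , i′∈z , e) = subst (_∈ z) (toℕ-injective e) i′∈z

∈ᵖ⇒< : {z : Subset n} → t ∈ᵖ z → t < n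
∈ᵖ⇒< (i , _ , refl) = toℕ<n i

∈ᵖ-mono : {x z : Subset n} → x ⊆ z → t ∈ᵖ x → t ∈ᵖ z
∈ᵖ-mono x⊆z (i , i∈x , e) = i , x⊆z i∈x , e

⊆-fromPositions : {x z : Subset n} → (∀ {t} → t ∈ᵖ x → t ∈ᵖ z) → x ⊆ z
⊆-fromPositions h i∈x = ∈ᵖ⇒∈ (h (∈⇒∈ᵖ i∈x))

∈ᵖ⊤ : t < n → t ∈ᵖ ⊤ {n}
∈ᵖ⊤ t<n = fromℕ< t<n , ∈⊤ , toℕ-fromℕ< t<n

∉ᵖ⊥ : ¬ t ∈ᵖ ⊥ {n}
∉ᵖ⊥ (_ , i∈⊥ , _) = ∉⊥ i∈⊥

_∈ᵖ?_ : (t : ℕ) (z : Subset n) → Dec (t ∈ᵖ z)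
t ∈ᵖ? z = any? λ i → (i ∈? z) ×-dec (toℕ i ≟ t)

∈ᵖ-∪ˡ : {x y : Subset n} → t ∈ᵖ x → t ∈ᵖ x ∪ y
∈ᵖ-∪ˡ {y = y} = ∈ᵖ-mono (p⊆p∪q y)

∈ᵖ-∪ʳ : {x y : Subset n} → t ∈ᵖ y → t ∈ᵖ x ∪ y
∈ᵖ-∪ʳ {x = x} {y} = ∈ᵖ-mono (q⊆p∪q x y)

∈ᵖ-∪⁻ : (x y : Subset n) → t ∈ᵖ x ∪ y → t ∈ᵖ x ⊎ t ∈ᵖ y
∈ᵖ-∪⁻ x y (i , i∈x∪y , e) =
  Sum.map (λ i∈x → i , i∈x , e) (λ i∈y → i , i∈y , e) (x∈p∪q⁻ x y i∈x∪y)

DividesPositions : ℕ → Subset n → Set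
DividesPositions d z = ∀ {t} → t ∈ᵖ z → d ∣ t

Spanning : Subset (suc N) → Set
Spanning {N} z = 0 ∈ᵖ z × N ∈ᵖ z × (∀ d → DividesPositions d z → d ≡ 1)

Spanning-mono : {w z : Subset (suc N)} → w ⊆ z → Spanning w → Spanning z
Spanning-mono w⊆z (0∈w , N∈w , coprime) =
  ∈ᵖ-mono w⊆z 0∈w , ∈ᵖ-mono w⊆z N∈w , λ d d∣z → coprime d (λ t∈w → d∣z (∈ᵖ-mono w⊆z t∈w))

consecutive⇒coprime : {w : Subset n} → t ∈ᵖ w → suc t ∈ᵖ w → ∀ d → DividesPositions d w → d ≡ 1
consecutive⇒coprime {t = t} t∈w 1+t∈w d d∣w =
  ∣1⇒≡1 (∣m+n∣m⇒∣n (subst (d ∣_) (+-comm 1 t) (d∣w 1+t∈w)) (d∣w t∈w))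

record Progression (z : Subset n) : Set where
  field
    start step length : ℕ
    positions : t ∈ᵖ z ⇔ (Σ ℕ λ j → j < length × t ≡ start + j * step)

IsAP⇒Progression : {z : Subset n} → IsAP n z → Progression z
IsAP⇒Progression {n} {z} (suc a , r , k , s≤s _ , _ , bounded , spec) =
  record { start = a ; step = r ; length = k ; positions = mk⇔ to′ from′ }
  where
  to′ : t ∈ᵖ z → Σ ℕ λ j → j < k × t ≡ a + j * r
  to′ (i , i∈z , refl) = Product.map₂ (Product.map₂ suc-injective) (to (spec i) i∈z)

  from′ : (Σ ℕ λ j → j < k × t ≡ a + j * r) → t ∈ᵖ z
  from′ (j , j<k , refl) =
    i , from (spec i) (j , j<k , cong suc (toℕ-fromℕ< (bounded j j<k))) , toℕ-fromℕ< (bounded j j<k)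
    where i = fromℕ< (bounded j j<k)

Progression⇒IsAP : {z : Subset n} (P : Progression z) → 1 ≤ Progression.step P → IsAP n z
Progression⇒IsAP {n} {z} P 1≤step =
  suc start , step , length , s≤s z≤n , 1≤step , bounded , spec
  where
  open Progression P

  bounded : ∀ j → j < length → suc start + j * step ≤ n
  bounded j j<length = ∈ᵖ⇒< (from positions (j , j<length , refl))

  spec : ∀ i → i ∈ z ⇔ (Σ ℕ λ j → j < length × suc (toℕ i) ≡ suc start + j * step)
  spec i = mk⇔
    (λ i∈z → Product.map₂ (Product.map₂ (cong suc)) (to positions (∈⇒∈ᵖ i∈z)))
    (λ (j , j<length , e) → ∈ᵖ⇒∈ (from positions (j , j<length , suc-injective e)))

gcdUpTo : (ℕ → ℕ) → ℕ → ℕ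
gcdUpTo f zero    = 0
gcdUpTo f (suc k) = gcd (gcdUpTo f k) (f k)

gcdUpTo-∣ : ∀ f → j < k → gcdUpTo f k ∣ f j
gcdUpTo-∣ {k = suc k} f (s≤s j≤k) with m≤n⇒m<n∨m≡n j≤k
... | inj₁ j<k  = ∣-trans (gcd[m,n]∣m (gcdUpTo f k) (f k)) (gcdUpTo-∣ f j<k)
... | inj₂ refl = gcd[m,n]∣n (gcdUpTo f k) (f k)

∣-gcdUpTo : ∀ f → (∀ j → j < k → d ∣ f j) → d ∣ gcdUpTo f k
∣-gcdUpTo {zero}  {d} f _   = d ∣0
∣-gcdUpTo {suc k}     f d∣f =
  gcd-greatest (∣-gcdUpTo f (λ j j<k → d∣f j (m≤n⇒m≤1+n j<k))) (d∣f k ≤-refl)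

module _ {z : Subset n} (P : Progression z) where
  open Progression P

  positionGcd : ℕ
  positionGcd = gcdUpTo (λ j → start + j * step) length

  positionGcd-∣ : DividesPositions positionGcd z
  positionGcd-∣ t∈z with to positions t∈z
  ... | j , j<length , refl = gcdUpTo-∣ _ j<length

  ∣-positionGcd : DividesPositions d z → d ∣ positionGcd
  ∣-positionGcd d∣z = ∣-gcdUpTo _ (λ j j<length → d∣z (from positions (j , j<length , refl)))

progression-full : {z : Subset (suc N)} → Progression z → Spanning z → z ≡ ⊤
progression-full {N} {z} P (0∈z , N∈z , coprime) =
  ⊆-antisym ⊆⊤ (⊆-fromPositions λ t∈⊤ →
    from positions (_ , ≤-<-trans (s≤s⁻¹ (∈ᵖ⇒< t∈⊤)) N<length , sym (index _)))
  where
  open Progression P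

  start≡0 : start ≡ 0
  start≡0 = let (_ , _ , 0≡start+_) = to positions 0∈z in m+n≡0⇒m≡0 start (sym 0≡start+_)

  step∣z : DividesPositions step z
  step∣z t∈z = let (j , _ , t≡start+_) = to positions t∈z in
    divides j (trans t≡start+_ (cong (_+ j * step) start≡0))

  index : ∀ j → start + j * step ≡ j
  index j = trans (cong₂ (λ a r → a + j * r) start≡0 (coprime step step∣z)) (*-identityʳ j)

  N<length : N < length
  N<length = let (j , j<length , N≡start+_) = to positions N∈z in
    subst (_< length) (trans (sym (index j)) (sym N≡start+_)) j<length

ap : (n a r k : ℕ) → Subset n
ap n a r k = tabulate λ i → ⌊ anyUpTo? (λ j → toℕ i ≟ a + j * r) k ⌋

∈-ap : {i : Fin n} → i ∈ ap n a r k ⇔ (Σ ℕ λ j → j < k × toℕ i ≡ a + j * r)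
∈-ap {n} {a} {r} {k} {i} = mk⇔
  (λ i∈ap → toWitness (from T-≡ (trans (sym (lookup∘tabulate entry i)) ([]=⇒lookup i∈ap))))
  (λ h → lookup⇒[]= i (ap n a r k) (trans (lookup∘tabulate entry i) (to T-≡ (fromWitness h))))
  where
  entry = λ (i : Fin n) → ⌊ anyUpTo? (λ j → toℕ i ≟ a + j * r) k ⌋

∈ᵖ-ap⁻ : t ∈ᵖ ap n a r k → Σ ℕ λ j → j < k × t ≡ a + j * r
∈ᵖ-ap⁻ (i , i∈ap , refl) = to ∈-ap i∈ap

module _ (bounded : ∀ j → j < k → a + j * r < n) where
  ap-progression : Progression (ap n a r k)
  ap-progression = record { start = a ; step = r ; length = k ; positions = mk⇔ ∈ᵖ-ap⁻ from′ }
    where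
    from′ : (Σ ℕ λ j → j < k × t ≡ a + j * r) → t ∈ᵖ ap n a r k
    from′ (j , j<k , refl) =
      fromℕ< (bounded j j<k) , from ∈-ap (j , j<k , toℕ-fromℕ< _) , toℕ-fromℕ< _

  ap-isAP : 1 ≤ r → IsAP n (ap n a r k)
  ap-isAP = Progression⇒IsAP ap-progression

  ∈ᵖ-ap : j < k → (a + j * r) ∈ᵖ ap n a r k
  ∈ᵖ-ap j<k = from (Progression.positions ap-progression) (_ , j<k , refl)

interval : (n a k : ℕ) → Subset n
interval n a k = ap n a 1 k

module _ (a k : ℕ) (k+a≤n : k + a ≤ n) where
  private
    a+j*1≡j+a : ∀ j → a + j * 1 ≡ j + a
    a+j*1≡j+a j = trans (cong (a +_) (*-identityʳ j)) (+-comm a j)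

    bounded : ∀ j → j < k → a + j * 1 < n
    bounded j j<k = subst (_< n) (sym (a+j*1≡j+a j)) (<-≤-trans (+-monoˡ-< a j<k) k+a≤n)

  interval-isAP : IsAP n (interval n a k)
  interval-isAP = ap-isAP bounded (s≤s z≤n)

  ∈ᵖ-interval : j < k → (j + a) ∈ᵖ interval n a k
  ∈ᵖ-interval {j} j<k = subst (_∈ᵖ interval n a k) (a+j*1≡j+a j) (∈ᵖ-ap bounded j<k)

∈ᵖ-interval⁻ : t ∈ᵖ interval n a k → Σ ℕ λ j → j < k × t ≡ j + a
∈ᵖ-interval⁻ {a = a} t∈ with ∈ᵖ-ap⁻ t∈
... | j , j<k , refl = j , j<k , trans (cong (a +_) (*-identityʳ j)) (+-comm a j)

multiples : (n d K : ℕ) → Subset n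
multiples n d K = ap n 0 d (suc K)

module _ {K : ℕ} (K*d<n : K * d < n) where
  private
    bounded : ∀ j → j < suc K → j * d < n
    bounded j j<1+K = ≤-<-trans (*-monoˡ-≤ d (s≤s⁻¹ j<1+K)) K*d<n

  multiples-isAP : 1 ≤ d → IsAP n (multiples n d K)
  multiples-isAP = ap-isAP bounded

  ∈ᵖ-multiples : j ≤ K → (j * d) ∈ᵖ multiples n d K
  ∈ᵖ-multiples j≤K = ∈ᵖ-ap bounded (s≤s j≤K)

∈ᵖ-multiples⁻ : ∀ {K} → t ∈ᵖ multiples n d K → Σ ℕ λ j → j ≤ K × t ≡ j * d
∈ᵖ-multiples⁻ t∈ = Product.map₂ (Product.map₁ s≤s⁻¹) (∈ᵖ-ap⁻ t∈)

joinIsTop⇐Spanning : {x y : Subset (suc N)} → Spanning (x ∪ y) → JoinIsTop (suc N) x y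
joinIsTop⇐Spanning {x = x} {y} spanning z zAP x⊆z y⊆z =
  subst (⊤ ⊆_) (sym z≡⊤) ⊆-refl
  where
  z≡⊤ : z ≡ ⊤
  z≡⊤ = progression-full (IsAP⇒Progression zAP)
    (Spanning-mono (λ i∈x∪y → [ x⊆z , y⊆z ]′ (x∈p∪q⁻ x y i∈x∪y)) spanning)

module _ {x y : Subset (suc (suc M))} (join : JoinIsTop (suc (suc M)) x y) where
  private
    covered : {z : Subset (suc (suc M))} → IsAP _ z →
              (∀ {t} → t ∈ᵖ x ∪ y → t ∈ᵖ z) → t ≤ suc M → t ∈ᵖ z
    covered {z = z} zAP x∪y⊆z t≤N =
      ∈ᵖ-mono (join z zAP (sub (p⊆p∪q y)) (sub (q⊆p∪q x y))) (∈ᵖ⊤ (s≤s t≤N))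
      where
      sub : ∀ {w} → w ⊆ x ∪ y → w ⊆ z
      sub w⊆x∪y = ⊆-trans w⊆x∪y (⊆-fromPositions x∪y⊆z)

    0∈x∪y : 0 ∈ᵖ x ∪ y
    0∈x∪y with 0 ∈ᵖ? (x ∪ y)
    ... | yes 0∈ = 0∈
    ... | no 0∉ = contradiction (covered (interval-isAP 1 (suc M) bound) above0 z≤n) 0∉above
      where
      bound : suc M + 1 ≤ suc (suc M)
      bound = ≤-reflexive (+-comm (suc M) 1)
      above0 : ∀ {t} → t ∈ᵖ x ∪ y → t ∈ᵖ interval (suc (suc M)) 1 (suc M)
      above0 {zero}  0∈ = contradiction 0∈ 0∉
      above0 {suc t} t∈ = subst (_∈ᵖ interval (suc (suc M)) 1 (suc M)) (+-comm t 1)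
        (∈ᵖ-interval 1 (suc M) bound (s<s⁻¹ (∈ᵖ⇒< t∈)))
      0∉above : ¬ 0 ∈ᵖ interval (suc (suc M)) 1 (suc M)
      0∉above 0∈ = let (j , _ , 0≡j+1) = ∈ᵖ-interval⁻ 0∈ in
        contradiction (m+n≡0⇒n≡0 j (sym 0≡j+1)) λ ()

    N∈x∪y : suc M ∈ᵖ x ∪ y
    N∈x∪y with suc M ∈ᵖ? (x ∪ y)
    ... | yes N∈ = N∈
    ... | no N∉ = contradiction (covered (interval-isAP 0 (suc M) bound) belowN ≤-refl) N∉below
      where
      bound : suc M + 0 ≤ suc (suc M)
      bound = m≤n⇒m≤1+n (≤-reflexive (+-identityʳ (suc M)))
      belowN : ∀ {t} → t ∈ᵖ x ∪ y → t ∈ᵖ interval (suc (suc M)) 0 (suc M)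
      belowN {t} t∈ = subst (_∈ᵖ interval (suc (suc M)) 0 (suc M)) (+-identityʳ t)
        (∈ᵖ-interval 0 (suc M) bound
          (≤∧≢⇒< (s≤s⁻¹ (∈ᵖ⇒< t∈)) λ t≡N → N∉ (subst (_∈ᵖ x ∪ y) t≡N t∈)))
      N∉below : ¬ suc M ∈ᵖ interval (suc (suc M)) 0 (suc M)
      N∉below N∈ = let (j , j<N , N≡j+0) = ∈ᵖ-interval⁻ N∈ in
        <-irrefl (trans (sym (+-identityʳ j)) (sym N≡j+0)) j<N

    coprime : ∀ d → DividesPositions d (x ∪ y) → d ≡ 1
    coprime zero      0∣x∪y = contradiction (0∣⇒≡0 (0∣x∪y N∈x∪y)) λ ()
    coprime d@(suc _) d∣x∪y with d∣x∪y N∈x∪y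
    ... | divides K N≡K*d =
      let (j , _ , 1≡j*d) = ∈ᵖ-multiples⁻ (covered (multiples-isAP K*d<n (s≤s z≤n)) multiple (s≤s z≤n))
      in ∣1⇒≡1 (divides j 1≡j*d)
      where
      K*d<n : K * d < suc (suc M)
      K*d<n = s≤s (≤-reflexive (sym N≡K*d))
      multiple : ∀ {t} → t ∈ᵖ x ∪ y → t ∈ᵖ multiples _ d K
      multiple t∈ with d∣x∪y t∈
      ... | divides c refl =
        ∈ᵖ-multiples K*d<n (*-cancelʳ-≤ c K d (subst (c * d ≤_) N≡K*d (s≤s⁻¹ (∈ᵖ⇒< t∈))))

  joinIsTop⇒Spanning : Spanning (x ∪ y)
  joinIsTop⇒Spanning = 0∈x∪y , N∈x∪y , coprime

Disjoint : Subset n → Subset n → Set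
Disjoint x y = ∀ {t} → t ∈ᵖ x → ¬ t ∈ᵖ y

meetIsBot⇐Disjoint : {x y : Subset n} → Disjoint x y → MeetIsBot n x y
meetIsBot⇐Disjoint disjoint z _ z⊆x z⊆y i∈z =
  contradiction (∈⇒∈ᵖ (z⊆y i∈z)) (disjoint (∈⇒∈ᵖ (z⊆x i∈z)))

disjoint-interval : {x : Subset n} (a k : ℕ) →
                    (∀ j → j < k → ¬ (j + a) ∈ᵖ x) → Disjoint x (interval n a k)
disjoint-interval _ _ outside t∈x t∈interval with ∈ᵖ-interval⁻ t∈interval
... | j , j<k , refl = outside j j<k t∈x

HasComplement : (n : ℕ) → Subset n → Set
HasComplement n x = Σ (Subset n) λ y → IsAP n y × JoinIsTop n x y × MeetIsBot n x y

complement-intro : {x : Subset (suc N)} (y : Subset (suc N)) →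
                   IsAP (suc N) y → Spanning (x ∪ y) → Disjoint x y → HasComplement (suc N) x
complement-intro y yAP spanning disjoint = y , yAP , joinIsTop⇐Spanning spanning , meetIsBot⇐Disjoint disjoint

module _ {x : Subset (suc (suc M))} where
  complement-∋0∋N : 0 ∈ᵖ x → suc M ∈ᵖ x → HasComplement _ x
  complement-∋0∋N 0∈x N∈x with 1 ∈ᵖ? x
  ... | yes 1∈x = complement-intro (interval _ 0 0) (interval-isAP 0 0 z≤n)
    (∈ᵖ-∪ˡ 0∈x , ∈ᵖ-∪ˡ N∈x , consecutive⇒coprime (∈ᵖ-∪ˡ 0∈x) (∈ᵖ-∪ˡ 1∈x))
    (disjoint-interval 0 0 λ _ ())
  ... | no 1∉x = complement-intro (interval _ 1 1) (interval-isAP 1 1 2≤n)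
    (∈ᵖ-∪ˡ 0∈x , ∈ᵖ-∪ˡ N∈x , consecutive⇒coprime (∈ᵖ-∪ˡ 0∈x) (∈ᵖ-∪ʳ 1∈y))
    (disjoint-interval 1 1 λ { zero _ → 1∉x ; (suc _) (s≤s ()) })
    where
    2≤n : 2 ≤ suc (suc M)
    2≤n = s≤s (s≤s z≤n)
    1∈y : 1 ∈ᵖ interval _ 1 1
    1∈y = ∈ᵖ-interval 1 1 2≤n z<s

  complement-∋0∌N : 0 ∈ᵖ x → ¬ suc M ∈ᵖ x → HasComplement _ x
  complement-∋0∌N 0∈x N∉x with M ∈ᵖ? x
  ... | yes M∈x = complement-intro (interval _ (suc M) 1) (interval-isAP (suc M) 1 ≤-refl)
    (∈ᵖ-∪ˡ 0∈x , ∈ᵖ-∪ʳ N∈y , consecutive⇒coprime (∈ᵖ-∪ˡ M∈x) (∈ᵖ-∪ʳ N∈y))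
    (disjoint-interval (suc M) 1 λ { zero _ → N∉x ; (suc _) (s≤s ()) })
    where
    N∈y : suc M ∈ᵖ interval _ (suc M) 1
    N∈y = ∈ᵖ-interval (suc M) 1 ≤-refl z<s
  ... | no M∉x = complement-intro (interval _ M 2) (interval-isAP M 2 ≤-refl)
    (∈ᵖ-∪ˡ 0∈x , ∈ᵖ-∪ʳ N∈y , consecutive⇒coprime (∈ᵖ-∪ʳ M∈y) (∈ᵖ-∪ʳ N∈y))
    (disjoint-interval M 2 λ { zero _ → M∉x ; (suc zero) _ → N∉x ; (suc (suc _)) (s≤s (s≤s ())) })
    where
    M∈y : M ∈ᵖ interval _ M 2
    M∈y = ∈ᵖ-interval M 2 ≤-refl z<s
    N∈y : suc M ∈ᵖ interval _ M 2
    N∈y = ∈ᵖ-interval M 2 ≤-refl (s<s z<s)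

  complement-∌0∋N : ¬ 0 ∈ᵖ x → suc M ∈ᵖ x → HasComplement _ x
  complement-∌0∋N 0∉x N∈x with 1 ∈ᵖ? x
  ... | yes 1∈x = complement-intro (interval _ 0 1) (interval-isAP 0 1 (s≤s z≤n))
    (∈ᵖ-∪ʳ 0∈y , ∈ᵖ-∪ˡ N∈x , consecutive⇒coprime (∈ᵖ-∪ʳ 0∈y) (∈ᵖ-∪ˡ 1∈x))
    (disjoint-interval 0 1 λ { zero _ → 0∉x ; (suc _) (s≤s ()) })
    where
    0∈y : 0 ∈ᵖ interval _ 0 1
    0∈y = ∈ᵖ-interval 0 1 (s≤s z≤n) z<s
  ... | no 1∉x = complement-intro (interval _ 0 2) (interval-isAP 0 2 2≤n)
    (∈ᵖ-∪ʳ 0∈y , ∈ᵖ-∪ˡ N∈x , consecutive⇒coprime (∈ᵖ-∪ʳ 0∈y) (∈ᵖ-∪ʳ 1∈y))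
    (disjoint-interval 0 2 λ { zero _ → 0∉x ; (suc zero) _ → 1∉x ; (suc (suc _)) (s≤s (s≤s ())) })
    where
    2≤n : 2 ≤ suc (suc M)
    2≤n = s≤s (s≤s z≤n)
    0∈y : 0 ∈ᵖ interval _ 0 2
    0∈y = ∈ᵖ-interval 0 2 2≤n z<s
    1∈y : 1 ∈ᵖ interval _ 0 2
    1∈y = ∈ᵖ-interval 0 2 2≤n (s<s z<s)

squarefree-coprime : ∀ {m s g} → Squarefree m → m ≡ s * g → Coprime s g
squarefree-coprime squarefree m≡s*g {e} (e∣s , e∣g) =
  squarefree e (subst (e * e ∣_) (sym m≡s*g) (*-pres-∣ e∣s e∣g))

module _ {x : Subset (suc (suc M))} (squarefree : Squarefree (suc M))
         (P : Progression x) (0∉x : ¬ 0 ∈ᵖ x) (N∉x : ¬ suc M ∈ᵖ x) where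
  private
    G g : ℕ
    G = positionGcd P
    g = gcd G (suc M)

    g∣N : g ∣ suc M
    g∣N = gcd[m,n]∣n G (suc M)

    s : ℕ
    s = _∣_.quotient g∣N

    N≡g*s : suc M ≡ g * s
    N≡g*s = m∣n⇒n≡m*quotient g∣N

    coprime : Coprime s g
    coprime = squarefree-coprime squarefree (_∣_.equality g∣N)

    1≤g : 1 ≤ g
    1≤g = n≢0⇒n>0 (gcd[m,n]≢0 G (suc M) (inj₂ λ ()))

    g*s<n : g * s < suc (suc M)
    g*s<n = s≤s (≤-reflexive (sym N≡g*s))

    y : Subset (suc (suc M))
    y = multiples _ s g

    N∈y : suc M ∈ᵖ y
    N∈y = subst (_∈ᵖ y) (sym N≡g*s) (∈ᵖ-multiples g*s<n ≤-refl)

    s∈y : s ∈ᵖ y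
    s∈y = subst (_∈ᵖ y) (*-identityˡ s) (∈ᵖ-multiples g*s<n 1≤g)

    spanning : Spanning (x ∪ y)
    spanning = ∈ᵖ-∪ʳ (∈ᵖ-multiples g*s<n z≤n) , ∈ᵖ-∪ʳ N∈y , λ d d∣x∪y →
      coprime (d∣x∪y (∈ᵖ-∪ʳ s∈y) ,
               gcd-greatest (∣-positionGcd P (λ t∈x → d∣x∪y (∈ᵖ-∪ˡ t∈x))) (d∣x∪y (∈ᵖ-∪ʳ N∈y)))

    -- A common position j·s has g ∣ j·s, hence g ∣ j, so it is one of the ends 0, N.
    disjoint : Disjoint x y
    disjoint t∈x t∈y with ∈ᵖ-multiples⁻ t∈y
    ... | zero    , _   , refl = 0∉x t∈x
    ... | suc j-1 , j≤g , refl = N∉x (subst (_∈ᵖ x) (trans (cong (_* s) j≡g) (sym N≡g*s)) t∈x)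
      where
      g∣j : g ∣ suc j-1
      g∣j = coprime-divisor (Coprime.sym coprime)
        (subst (g ∣_) (*-comm (suc j-1) s) (∣-trans (gcd[m,n]∣m G (suc M)) (positionGcd-∣ P t∈x)))
      j≡g : suc j-1 ≡ g
      j≡g = ≤-antisym j≤g (∣⇒≤ g∣j)

    1≤s : 1 ≤ s
    1≤s = >-nonZero⁻¹ s {{quotient≢0 g∣N}}

  complement-∌0∌N : HasComplement _ x
  complement-∌0∌N = complement-intro y (multiples-isAP g*s<n 1≤s) spanning disjoint

squarefree⇒complemented : Squarefree (suc M) → Complemented (suc (suc M))
squarefree⇒complemented {M} squarefree x xAP with 0 ∈ᵖ? x | suc M ∈ᵖ? x
... | yes 0∈x | yes N∈x = complement-∋0∋N 0∈x N∈x
... | yes 0∈x | no  N∉x = complement-∋0∌N 0∈x N∉x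
... | no  0∉x | yes N∈x = complement-∌0∋N 0∉x N∈x
... | no  0∉x | no  N∉x = complement-∌0∌N squarefree (IsAP⇒Progression xAP) 0∉x N∉x

OnlyTopSemicomplement : (n : ℕ) → Subset n → Set
OnlyTopSemicomplement n x = ∀ y → IsAP n y → JoinIsTop n x y → y ≡ ⊤

onlyTopSemicomplement⇒¬complemented : {x : Subset n} → IsAP n x → x ≢ ⊥ →
                                       OnlyTopSemicomplement n x → ¬ Complemented n
onlyTopSemicomplement⇒¬complemented {x = x} xAP x≢⊥ onlyTop complemented =
  let (y , yAP , join , meet) = complemented x xAP in
  x≢⊥ (⊆-antisym (meet x xAP ⊆-refl (subst (x ⊆_) (sym (onlyTop y yAP join)) ⊆⊤)) ⊥⊆)

module _ {M p : ℕ} (2≤p : 2 ≤ p) (p²∣N : p * p ∣ suc M) where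
  private
    q m : ℕ
    q = _∣_.quotient p²∣N
    m = p * q

    N≡m*p : suc M ≡ m * p
    N≡m*p = trans (_∣_.equality p²∣N) (rearrange p q)
      where
      rearrange : ∀ p q → q * (p * p) ≡ p * q * p
      rearrange = solve-∀

    m≢0 : m ≢ 0
    m≢0 m≡0 = contradiction (trans N≡m*p (cong (_* p) m≡0)) λ ()

    m<N : m < suc M
    m<N = subst (m <_) (sym N≡m*p) (m<m*n m p {{≢-nonZero m≢0}} 2≤p)

    m<n : m < suc (suc M)
    m<n = m≤n⇒m≤1+n m<N

    x : Subset (suc (suc M))
    x = interval _ m 1

    m∈x : m ∈ᵖ x
    m∈x = ∈ᵖ-interval m 1 m<n z<s

    ∈x⇒≡m : t ∈ᵖ x → t ≡ m
    ∈x⇒≡m t∈x with ∈ᵖ-interval⁻ t∈x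
    ... | zero  , _      , t≡m = t≡m
    ... | suc _ , s≤s () , _

    x≢⊥ : x ≢ ⊥
    x≢⊥ x≡⊥ = ∉ᵖ⊥ (subst (m ∈ᵖ_) x≡⊥ m∈x)

    x≢⊤ : x ≢ ⊤
    x≢⊤ x≡⊤ = m≢0 (sym (∈x⇒≡m (subst (0 ∈ᵖ_) (sym x≡⊤) (∈ᵖ⊤ z<s))))

    onlyTop : OnlyTopSemicomplement _ x
    onlyTop y yAP join = progression-full (IsAP⇒Progression yAP) (0∈y , N∈y , coprime-y)
      where
      spanning : Spanning (x ∪ y)
      spanning = joinIsTop⇒Spanning join

      ∈y : t ∈ᵖ x ∪ y → t ≢ m → t ∈ᵖ y
      ∈y t∈x∪y t≢m =
        [ (λ t∈x → contradiction (∈x⇒≡m t∈x) t≢m) , (λ t∈y → t∈y) ]′ (∈ᵖ-∪⁻ x y t∈x∪y)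

      0∈y : 0 ∈ᵖ y
      0∈y = ∈y (proj₁ spanning) λ 0≡m → m≢0 (sym 0≡m)

      N∈y : suc M ∈ᵖ y
      N∈y = ∈y (proj₁ (proj₂ spanning)) (>⇒≢ m<N)

      coprime-y : ∀ d → DividesPositions d y → d ≡ 1
      coprime-y d d∣y = d⊥m (∣-refl , ∣m⇒∣m*n q d∣p)
        where
        d⊥m : Coprime d m
        d⊥m (e∣d , e∣m) = proj₂ (proj₂ spanning) _ λ t∈x∪y →
          [ (λ t∈x → subst (_ ∣_) (sym (∈x⇒≡m t∈x)) e∣m) , (λ t∈y → ∣-trans e∣d (d∣y t∈y)) ]′
            (∈ᵖ-∪⁻ x y t∈x∪y)

        d∣p : d ∣ p
        d∣p = coprime-divisor d⊥m (subst (d ∣_) N≡m*p (d∣y N∈y))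

  squareDivisor⇒onlyTopSemicomplement :
    Σ (Subset (suc (suc M))) λ x → IsAP _ x × x ≢ ⊥ × x ≢ ⊤ × OnlyTopSemicomplement _ x
  squareDivisor⇒onlyTopSemicomplement = x , interval-isAP m 1 m<n , x≢⊥ , x≢⊤ , onlyTop

nontrivialSquareDivisor : d * d ∣ suc M → d ≢ 1 → 2 ≤ d
nontrivialSquareDivisor {zero}        0∣N _   = contradiction (0∣⇒≡0 0∣N) λ ()
nontrivialSquareDivisor {suc zero}    _   d≢1 = contradiction refl d≢1
nontrivialSquareDivisor {suc (suc _)} _   _   = s≤s (s≤s z≤n)

¬squarefree⇒squareDivisor : ¬ Squarefree (suc M) → Σ ℕ λ p → 2 ≤ p × p * p ∣ suc M
¬squarefree⇒squareDivisor {M} ¬squarefree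
  with anyUpTo? (λ p → (2 ≤? p) ×-dec (p * p ∣? suc M)) (suc (suc M))
... | yes (p , _ , square) = p , square
... | no none = contradiction squarefree ¬squarefree
  where
  squarefree : Squarefree (suc M)
  squarefree d d²∣N with d ≟ 1
  ... | yes d≡1 = d≡1
  ... | no  d≢1 = contradiction (d , s≤s d≤N , 2≤d , d²∣N) none
    where
    2≤d : 2 ≤ d
    2≤d = nontrivialSquareDivisor d²∣N d≢1
    d≤N : d ≤ suc M
    d≤N = ≤-trans (m≤m*n d d {{>-nonZero (<⇒≤ 2≤d)}}) (∣⇒≤ d²∣N)

complemented⇒squarefree : Complemented (suc (suc M)) → Squarefree (suc M)
complemented⇒squarefree complemented d d²∣N with d ≟ 1
... | yes d≡1 = d≡1
... | no  d≢1 =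
  let (x , xAP , x≢⊥ , _ , onlyTop) =
        squareDivisor⇒onlyTopSemicomplement (nontrivialSquareDivisor d²∣N d≢1) d²∣N
  in contradiction complemented (onlyTopSemicomplement⇒¬complemented xAP x≢⊥ onlyTop)

theorem13 : ∀ (n : ℕ) → 2 ≤ n →
    (Complemented n ⇔ Squarefree (n ∸ 1)) ×
    (¬ Squarefree (n ∸ 1) →
      Σ (Subset n) λ x → IsAP n x × x ≢ ⊥ × x ≢ ⊤ ×
        (∀ y → IsAP n y → JoinIsTop n x y → y ≡ ⊤))
theorem13 (suc (suc M)) (s≤s (s≤s z≤n)) =
  mk⇔ complemented⇒squarefree squarefree⇒complemented ,
  λ ¬squarefree →
    let (p , 2≤p , p²∣N) = ¬squarefree⇒squareDivisor ¬squarefree in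
    squareDivisor⇒onlyTopSemicomplement 2≤p p²∣N
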